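{- Let $N$ be a positive perfect square and let $H$ be the undirected unweighted graph with vertex set the disjoint union of $A=\{a[i,j]\}$, $B=\{b[i,j,k]\}$, $C=\{c[i,j,k]\}$, $D=\{d[i,j]\}$, where indices $i,j,x,y$ range over $[\sqrt N]$ and $k,z$ over $\{0,1\}$, and whose edges are exactly: $\{b[i,j,k],b[x,y,z]\}$ iff exactly one of $i=x$, $j=y$ holds; $\{c[i,j,k],c[x,y,z]\}$ iff exactly one of $i=x$, $j=y$ holds; $\{a[i,j],b[x,y,z]\}$ iff $i=x$ and $z=0$; $\{b[i,j,k],c[x,y,z]\}$ iff $i=x$ and $j=y$; $\{c[i,j,k],d[x,y]\}$ iff $j=y$ and $k=0$ (no other edges). Let $M$ be an arbitrary binary $\sqrt N\times\sqrt N\times\sqrt N$ array, and let $G\supseteq H$ be obtained by adding the edge $\{a[i,j],b[i,y,1]\}$ for all $i,j,y$ with $M[i,j,y]=1$, and the edge $\{c[i,y,1],d[x,y]\}$ for all $i,x,y$ with $M[i,x,y]=1$. For indices $i,j,x,y\in[\sqrt N]$ with $i\ne x$ and $j\ne y$, let $F=\{\{a[i,j],b[i,y,0]\},\{c[i,y,0],d[x,y]\}\}$ and $F'=\{\{a[i,j],b[i,y,1]\},\{c[i,y,1],d[x,y]\}\}$. Then the diameter of $G-(F\cup F')$ is at least $5$.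
   Context: $G-X$ denotes the graph obtained from $G$ by deleting those pairs in $X$ that are edges of $G$. The diameter of an unweighted graph is the maximum over vertex pairs of the shortest-path distance (number of edges). -}

module Defs where

open import Data.Nat using (ℕ; zero; suc; _≤_)
open import Data.Fin using (Fin; zero; suc)
open import Data.Bool using (Bool; true)
open import Data.Product using (_×_; Σ; ∃₂)
open import Data.Sum using (_⊎_)
open import Relation.Binary.PropositionalEquality using (_≡_; _≢_)
open import Relation.Nullary using (¬_)

data Walk {V : Set} (E : V → V → Set) : V → V → ℕ → Set where
  nil  : ∀ {u} → Walk E u u 0
  cons : ∀ {u w v n} → E u w → Walk E w v n → Walk E u v (suc n)

-- dist_E(u,v) ≥ k : every u–v walk has at least k edges
-- (shortest-path distance; infinite if no walk exists).
DistAtLeast : {V : Set} → (V → V → Set) → ℕ → V → V → Set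
DistAtLeast E k u v = ∀ n → Walk E u v n → k ≤ n

DiamAtLeast : {V : Set} → (V → V → Set) → ℕ → Set
DiamAtLeast {V} E k = ∃₂ λ (u v : V) → DistAtLeast E k u v

_∖_ : {V : Set} → (V → V → Set) → (V → V → Set) → (V → V → Set)
(E ∖ X) u v = E u v × ¬ X u v

Sym : {V : Set} → (V → V → Set) → (V → V → Set)
Sym R u v = R u v ⊎ R v u

-- The construction. s = √N; indices range over Fin s, k,z over Fin 2.

data Vtx (s : ℕ) : Set where
  a : Fin s → Fin s → Vtx s
  b : Fin s → Fin s → Fin 2 → Vtx s
  c : Fin s → Fin s → Fin 2 → Vtx s
  d : Fin s → Fin s → Vtx s

ExactlyOne : {s : ℕ} → Fin s → Fin s → Fin s → Fin s → Set
ExactlyOne i j x y = (i ≡ x × j ≢ y) ⊎ (i ≢ x × j ≡ y)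

-- edges of H, listed in one orientation
data HEdge {s : ℕ} : Vtx s → Vtx s → Set where
  bb : ∀ {i j k x y z} → ExactlyOne i j x y → HEdge (b i j k) (b x y z)
  cc : ∀ {i j k x y z} → ExactlyOne i j x y → HEdge (c i j k) (c x y z)
  ab : ∀ {i j y} → HEdge (a i j) (b i y zero)
  bc : ∀ {i j k z} → HEdge (b i j k) (c i j z)
  cd : ∀ {i j x} → HEdge (c i j zero) (d x j)

data MEdge {s : ℕ} (M : Fin s → Fin s → Fin s → Bool) : Vtx s → Vtx s → Set where
  ab1 : ∀ {i j y} → M i j y ≡ true → MEdge M (a i j) (b i y (suc zero))
  cd1 : ∀ {i x y} → M i x y ≡ true → MEdge M (c i y (suc zero)) (d x y)

H : (s : ℕ) → Vtx s → Vtx s → Set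
H s = Sym HEdge

G : (s : ℕ) → (Fin s → Fin s → Fin s → Bool) → Vtx s → Vtx s → Set
G s M = Sym (λ u v → HEdge u v ⊎ MEdge M u v)

data FF' {s : ℕ} (i j x y : Fin s) : Vtx s → Vtx s → Set where
  f₁  : FF' i j x y (a i j) (b i y zero)
  f₂  : FF' i j x y (c i y zero) (d x y)
  f₁' : FF' i j x y (a i j) (b i y (suc zero))
  f₂' : FF' i j x y (c i y (suc zero)) (d x y)

FuF' : {s : ℕ} → (i j x y : Fin s) → Vtx s → Vtx s → Set
FuF' i j x y = Sym (FF' i j x y)

{-# OPTIONS --safe #-}
module Submission where

open import Defs
open import Data.Nat using (ℕ; _*_; _<_; s≤s; z≤n; suc)
open import Data.Fin using (Fin)
open import Data.Bool using (Bool)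
open import Data.Product using (_×_; _,_; proj₁)
open import Data.Sum using (inj₁; inj₂)
open import Relation.Binary.PropositionalEquality using (_≡_; _≢_; refl; sym; ≢-sym)
open import Relation.Nullary using (¬_)

-- After deleting F ∪ F', every neighbour of a[i,j] is some b[i,y',k] with y' ≠ y,
-- and every neighbour of d[x,y] is some c[i',y,k] with i' ≠ i.  A b–c edge only
-- joins equal cells, and a b–b or c–c edge joins cells agreeing in exactly one
-- coordinate, so no path of length ≤ 2 links these two neighbourhoods.

ExactlyOne-sym : ∀ {s} {i j x y : Fin s} → ExactlyOne i j x y → ExactlyOne x y i j
ExactlyOne-sym (inj₁ (i≡x , j≢y)) = inj₁ (sym i≡x , ≢-sym j≢y)
ExactlyOne-sym (inj₂ (i≢x , j≡y)) = inj₂ (≢-sym i≢x , sym j≡y)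

¬ExactlyOne-of-≢ : ∀ {s} {i j x y : Fin s} → i ≢ x → j ≢ y → ¬ ExactlyOne i j x y
¬ExactlyOne-of-≢ i≢x _   (inj₁ (i≡x , _)) = i≢x i≡x
¬ExactlyOne-of-≢ _   j≢y (inj₂ (_ , j≡y)) = j≢y j≡y

module _ {s : ℕ} {M : Fin s → Fin s → Fin s → Bool} where

  G-b-c⇒same-cell : ∀ {p q r p′ q′ r′} → G s M (b p q r) (c p′ q′ r′) → p ≡ p′ × q ≡ q′
  G-b-c⇒same-cell (inj₁ (inj₁ bc)) = refl , refl
  G-b-c⇒same-cell (inj₁ (inj₂ ()))
  G-b-c⇒same-cell (inj₂ (inj₁ ()))
  G-b-c⇒same-cell (inj₂ (inj₂ ()))

  G-b-b⇒ExactlyOne : ∀ {p q r p′ q′ r′} → G s M (b p q r) (b p′ q′ r′) → ExactlyOne p q p′ q′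
  G-b-b⇒ExactlyOne (inj₁ (inj₁ (bb e))) = e
  G-b-b⇒ExactlyOne (inj₁ (inj₂ ()))
  G-b-b⇒ExactlyOne (inj₂ (inj₁ (bb e))) = ExactlyOne-sym e
  G-b-b⇒ExactlyOne (inj₂ (inj₂ ()))

  G-c-c⇒ExactlyOne : ∀ {p q r p′ q′ r′} → G s M (c p q r) (c p′ q′ r′) → ExactlyOne p q p′ q′
  G-c-c⇒ExactlyOne (inj₁ (inj₁ (cc e))) = e
  G-c-c⇒ExactlyOne (inj₁ (inj₂ ()))
  G-c-c⇒ExactlyOne (inj₂ (inj₁ (cc e))) = ExactlyOne-sym e
  G-c-c⇒ExactlyOne (inj₂ (inj₂ ()))

  ¬G-a-c : ∀ {p q p′ q′ r′} → ¬ G s M (a p q) (c p′ q′ r′)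
  ¬G-a-c (inj₁ (inj₁ ()))
  ¬G-a-c (inj₁ (inj₂ ()))
  ¬G-a-c (inj₂ (inj₁ ()))
  ¬G-a-c (inj₂ (inj₂ ()))

  ¬G-b-d : ∀ {p q r p′ q′} → ¬ G s M (b p q r) (d p′ q′)
  ¬G-b-d (inj₁ (inj₁ ()))
  ¬G-b-d (inj₁ (inj₂ ()))
  ¬G-b-d (inj₂ (inj₁ ()))
  ¬G-b-d (inj₂ (inj₂ ()))

  module _ (i j x y : Fin s) where

    data NeighbourOfA : Vtx s → Set where
      b-off-y : ∀ {y′ k} → y′ ≢ y → NeighbourOfA (b i y′ k)

    data NeighbourOfD : Vtx s → Set where
      c-off-i : ∀ {i′ k} → i′ ≢ i → NeighbourOfD (c i′ y k)

    private
      E : Vtx s → Vtx s → Set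
      E = G s M ∖ FuF' i j x y

    neighbourOfA : ∀ {w} → E (a i j) w → NeighbourOfA w
    neighbourOfA (inj₁ (inj₁ ab) , ∉F)       = b-off-y λ { refl → ∉F (inj₁ f₁) }
    neighbourOfA (inj₁ (inj₂ (ab1 _)) , ∉F)  = b-off-y λ { refl → ∉F (inj₁ f₁') }
    neighbourOfA (inj₂ (inj₁ ()) , _)
    neighbourOfA (inj₂ (inj₂ ()) , _)

    neighbourOfD : ∀ {w} → E w (d x y) → NeighbourOfD w
    neighbourOfD (inj₁ (inj₁ cd) , ∉F)       = c-off-i λ { refl → ∉F (inj₁ f₂) }
    neighbourOfD (inj₁ (inj₂ (cd1 _)) , ∉F)  = c-off-i λ { refl → ∉F (inj₁ f₂') }
    neighbourOfD (inj₂ (inj₁ ()) , _)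
    neighbourOfD (inj₂ (inj₂ ()) , _)

    ¬common-neighbour : ∀ {w} → NeighbourOfA w → ¬ NeighbourOfD w
    ¬common-neighbour (b-off-y _) ()

    ¬G-between-neighbours : ∀ {u w} → NeighbourOfA u → NeighbourOfD w → ¬ G s M u w
    ¬G-between-neighbours (b-off-y _) (c-off-i i′≢i) g with G-b-c⇒same-cell g
    ... | refl , refl = i′≢i refl

    ¬G-path₂-between-neighbours : ∀ {u v w} → NeighbourOfA u → NeighbourOfD w →
                                  G s M u v → ¬ G s M v w
    ¬G-path₂-between-neighbours {v = a _ _}   _ (c-off-i _) _ g′ = ¬G-a-c g′
    ¬G-path₂-between-neighbours {v = d _ _}   (b-off-y _) _ g _  = ¬G-b-d g
    ¬G-path₂-between-neighbours {v = b _ _ _} (b-off-y y′≢y) (c-off-i i′≢i) g g′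
      with G-b-c⇒same-cell g′
    ... | refl , refl = ¬ExactlyOne-of-≢ (≢-sym i′≢i) y′≢y (G-b-b⇒ExactlyOne g)
    ¬G-path₂-between-neighbours {v = c _ _ _} (b-off-y y′≢y) (c-off-i i′≢i) g g′
      with G-b-c⇒same-cell g
    ... | refl , refl = ¬ExactlyOne-of-≢ (≢-sym i′≢i) y′≢y (G-c-c⇒ExactlyOne g′)

    dist-a-d : DistAtLeast E 5 (a i j) (d x y)
    dist-a-d 0 ()
    dist-a-d 1 (cons e nil) with neighbourOfA e
    ... | ()
    dist-a-d 2 (cons e₁ (cons e₂ nil)) with () ← ¬common-neighbour (neighbourOfA e₁) (neighbourOfD e₂)
    dist-a-d 3 (cons e₁ (cons e₂ (cons e₃ nil)))
      with () ← ¬G-between-neighbours (neighbourOfA e₁) (neighbourOfD e₃) (proj₁ e₂)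
    dist-a-d 4 (cons e₁ (cons e₂ (cons e₃ (cons e₄ nil))))
      with () ← ¬G-path₂-between-neighbours (neighbourOfA e₁) (neighbourOfD e₄) (proj₁ e₂) (proj₁ e₃)
    dist-a-d (suc (suc (suc (suc (suc _))))) _ = s≤s (s≤s (s≤s (s≤s (s≤s z≤n))))

lemma12 : (N s : ℕ) → 0 < N → s * s ≡ N →
          (M : Fin s → Fin s → Fin s → Bool) →
          (i j x y : Fin s) → i ≢ x → j ≢ y →
          DiamAtLeast (G s M ∖ FuF' i j x y) 5
lemma12 _ s _ _ M i j x y _ _ = a i j , d x y , dist-a-d i j x y
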